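{- Let $\mathcal S\subseteq 2^X$ be a pointed even set family, let $\{e_i,e_j\}\subseteq X$ be a 2-set, and let $G_{1,2}(\mathcal S)=(V,E)$ and $G_{1,2}(\varphi_{ij}(\mathcal S))=(V',E')$. Then $|V|=|V'|$ and $|E|\le|E'|$.
   Context: $X$ is a finite set. A set family is even if all its sets have even cardinality and pointed if it contains $\varnothing$. The 1,2-inclusion graph $G_{1,2}(\mathcal F)$ of a family $\mathcal F$ has vertex set $\mathcal F$, and $A,B\in\mathcal F$ are adjacent iff $1\le|A\triangle B|\le 2$. The d-shifting with respect to $\{e_i,e_j\}$ is the map $\varphi_{ij}:\mathcal S\to 2^X$ with $\varphi_{ij}(S)=S\setminus\{e_i,e_j\}$ if $\{e_i,e_j\}\subseteq S$ and $S\setminus\{e_i,e_j\}\notin\mathcal S$, and $\varphi_{ij}(S)=S$ otherwise; $\varphi_{ij}(\mathcal S)=\{\varphi_{ij}(S):S\in\mathcal S\}$. -}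

module Defs where

open import Data.Nat using (ℕ; _≤_; zero; suc; _+_)
open import Data.Nat.Divisibility using (_∣_)
open import Data.Bool using (Bool; _xor_)
open import Data.Bool.Properties using () renaming (_≟_ to _≟ᵇ_)
open import Data.Fin using (Fin)
open import Data.Fin.Subset using (Subset; ∣_∣; ⊥; _∈_; _─_; ⁅_⁆; _∪_)
open import Data.Fin.Subset.Properties using (_∈?_)
open import Data.Vec using (zipWith)
open import Data.Vec.Properties using (≡-dec)
open import Data.List using (List; []; _∷_; length; filter; map; deduplicate)
open import Data.List.Membership.DecPropositional as DecMem using ()
open import Data.Product using (_×_)
open import Data.Nat.Properties using (_≤?_)
open import Relation.Nullary using (Dec; yes; no; _×-dec_)
open import Relation.Binary.PropositionalEquality using (_≡_)
open import Relation.Binary.Definitions using (DecidableEquality)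

-- Ground set X = Fin n; subsets of X are 'Subset n'.
-- A set family is a duplicate-free list of subsets.

_≟ˢ_ : {n : ℕ} → DecidableEquality (Subset n)
_≟ˢ_ = ≡-dec _≟ᵇ_

_∈ᶠ_ : {n : ℕ} → Subset n → List (Subset n) → Set
_∈ᶠ_ {n} = DecMem._∈_ (_≟ˢ_ {n})

_∈ᶠ?_ : {n : ℕ} → (A : Subset n) → (F : List (Subset n)) → Dec (A ∈ᶠ F)
_∈ᶠ?_ {n} = DecMem._∈?_ (_≟ˢ_ {n})

_△_ : {n : ℕ} → Subset n → Subset n → Subset n
A △ B = zipWith _xor_ A B

Even-family : {n : ℕ} → List (Subset n) → Set
Even-family F = ∀ A → A ∈ᶠ F → 2 ∣ ∣ A ∣

Pointed : {n : ℕ} → List (Subset n) → Set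
Pointed F = ⊥ ∈ᶠ F

Adj : {n : ℕ} → Subset n → Subset n → Set
Adj A B = (1 ≤ ∣ A △ B ∣) × (∣ A △ B ∣ ≤ 2)

Adj? : {n : ℕ} → (A B : Subset n) → Dec (Adj A B)
Adj? A B = (1 ≤? ∣ A △ B ∣) ×-dec (∣ A △ B ∣ ≤? 2)

-- number of vertices of G_{1,2}(F) (F duplicate-free)
vertices : {n : ℕ} → List (Subset n) → ℕ
vertices F = length F

-- number of edges of G_{1,2}(F): unordered pairs of distinct list positions
-- whose sets are adjacent (for duplicate-free F these are pairs of distinct sets)
edges : {n : ℕ} → List (Subset n) → ℕ
edges [] = 0
edges (A ∷ F) = length (filter (Adj? A) F) + edges F

φ : {n : ℕ} → Fin n → Fin n → List (Subset n) → Subset n → Subset n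
φ i j 𝒮 S with (i ∈? S) ×-dec (j ∈? S)
... | no _ = S
... | yes _ with (S ─ (⁅ i ⁆ ∪ ⁅ j ⁆)) ∈ᶠ? 𝒮
...   | yes _ = S
...   | no _ = S ─ (⁅ i ⁆ ∪ ⁅ j ⁆)

shift : {n : ℕ} → Fin n → Fin n → List (Subset n) → List (Subset n)
shift i j 𝒮 = deduplicate _≟ˢ_ (map (φ i j 𝒮) 𝒮)

module Submission where

-- Proof idea.  Write clear S = S ─ {i, j} and call S full when {i, j} ⊆ S;
-- the d-shift Φ = φ_ij replaces a full S ∈ 𝒮 by clear S exactly when
-- clear S ∉ 𝒮.
--
-- 1. Cardinality bookkeeping: counting i and j separately gives
--      ∣ A △ B ∣ = [A_i ≠ B_i] + [A_j ≠ B_j] + ∣ clear A △ clear B ∣,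
--    from which all distance comparisons between A, B, clear A, clear B follow.
-- 2. Counting: a map that is injective on a duplicate-free list and lands
--    in another list cannot decrease the length; and the ordered adjacent
--    pairs of a family number exactly twice its edges.
-- 3. Shifting: Φ is injective on 𝒮, which gives |V| = |V'|.  For edges we map
--    an ordered adjacent pair (A, B) to (Φ A, Φ B), except when A and B are
--    both full and exactly one of them moves ("torn"); then it goes to
--    (clear A, clear B).  This map is injective and lands in the adjacent pairs
--    of φ_ij(𝒮), so 2|E| ≤ 2|E'|.

open import Defs
open import Data.Nat using (ℕ; suc; _+_; _*_; _≤_; z≤n; s≤s)
open import Data.Nat.Properties
  using (≤-trans; ≤-reflexive; ≤-antisym; ≤-pred; n≤0⇒n≡0; n≮n; +-suc; *-cancelˡ-≤; +-commutativeSemigroup)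
open import Data.Nat.Tactic.RingSolver using (solve-∀)
open import Algebra.Properties.CommutativeSemigroup +-commutativeSemigroup using (x∙yz≈y∙xz)
open import Data.Bool using (Bool; true; false; not; _xor_)
open import Data.Bool.Properties using (xor-comm; ¬-not) renaming (_≟_ to _≟ᵇ_)
open import Data.Fin using (Fin; zero; suc)
open import Data.Fin.Subset using (Subset; ∣_∣; ⁅_⁆; _∪_; _─_; _-_) renaming (⊥ to ∅)
open import Data.Fin.Subset.Properties
  using (_∈?_; x∈⁅x⁆; x∈p∪q⁺; x≢y⇒x∉⁅y⁆; p─⊥≡p; p─q─r≡p─q∪r; p─q─q≡p─q)
open import Data.Vec using ([]; _∷_; lookup)
open import Data.Vec.Properties using (lookup-zipWith; zipWith-comm; []=⇒lookup; lookup⇒[]=)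
open import Data.List using (List; []; _∷_; length; map; filter; deduplicate; cartesianProduct; _++_)
open import Data.List.Properties
  using (length-filter; length-map; length-++; length-++-sucʳ; filter-++; filter-≐; filter-reject)
open import Data.List.Membership.Propositional using (_∈_; _∉_)
open import Data.List.Membership.Propositional.Properties
  using (∈-∃++; ∈-++⁻; ∈-++⁺ˡ; ∈-++⁺ʳ; ∈-map⁺; ∈-deduplicate⁺;
         ∈-filter⁺; ∈-filter⁻; ∈-cartesianProduct⁺; ∈-cartesianProduct⁻)
open import Data.List.Relation.Unary.Any using (here; there)
open import Data.List.Relation.Unary.All using () renaming (lookup to All-lookup)
open import Data.List.Relation.Unary.AllPairs using (_∷_)
open import Data.List.Relation.Unary.Unique.Propositional using (Unique)
open import Data.List.Relation.Unary.Unique.Propositional.Properties using (filter⁺; cartesianProduct⁺)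
open import Data.Product using (_×_; _,_; proj₁; proj₂)
open import Data.Sum using (_⊎_; inj₁; inj₂)
open import Data.Empty using (⊥; ⊥-elim)
open import Function using (_∘_)
open import Relation.Nullary using (¬_; Dec; yes; no; _×-dec_)
open import Relation.Nullary.Decidable using (_⊎-dec_; ¬?; map′)
open import Relation.Binary.PropositionalEquality
  using (_≡_; _≢_; refl; sym; trans; cong; cong₂; subst; subst₂; module ≡-Reasoning)

private
  variable
    n : ℕ

bit : Bool → ℕ
bit true  = 1
bit false = 0

lookup-─-outside : (p q : Subset n) (k : Fin n) → lookup q k ≡ false → lookup (p ─ q) k ≡ lookup p k
lookup-─-outside (x ∷ p) (false ∷ q) zero    refl = refl
lookup-─-outside (x ∷ p) (y ∷ q)     (suc k) e    = lookup-─-outside p q k e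

lookup-─-inside : (p q : Subset n) (k : Fin n) → lookup q k ≡ true → lookup (p ─ q) k ≡ false
lookup-─-inside (x ∷ p) (true ∷ q) zero    refl = refl
lookup-─-inside (x ∷ p) (y ∷ q)    (suc k) e    = lookup-─-inside p q k e

card-split : (p : Subset n) (k : Fin n) → ∣ p ∣ ≡ bit (lookup p k) + ∣ p - k ∣
card-split (true  ∷ p) zero    = cong (suc ∘ ∣_∣) (sym (p─⊥≡p p))
card-split (false ∷ p) zero    = cong ∣_∣ (sym (p─⊥≡p p))
card-split (true  ∷ p) (suc k) = trans (cong suc (card-split p k)) (sym (+-suc _ _))
card-split (false ∷ p) (suc k) = card-split p k

card-split₂ : {i j : Fin n} → i ≢ j → (p : Subset n) →
  ∣ p ∣ ≡ bit (lookup p i) + (bit (lookup p j) + ∣ p ─ (⁅ i ⁆ ∪ ⁅ j ⁆) ∣)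
card-split₂ {i = i} {j} i≢j p = begin
    ∣ p ∣
  ≡⟨ card-split p i ⟩
    bit (lookup p i) + ∣ p - i ∣
  ≡⟨ cong (bit (lookup p i) +_) (card-split (p - i) j) ⟩
    bit (lookup p i) + (bit (lookup (p - i) j) + ∣ p - i - j ∣)
  ≡⟨ cong₂ (λ b q → bit (lookup p i) + (bit b + ∣ q ∣))
           (lookup-─-outside p ⁅ i ⁆ j j∉⁅i⁆) (p─q─r≡p─q∪r p ⁅ i ⁆ ⁅ j ⁆) ⟩
    bit (lookup p i) + (bit (lookup p j) + ∣ p ─ (⁅ i ⁆ ∪ ⁅ j ⁆) ∣)
  ∎
  where
    open ≡-Reasoning
    j∉⁅i⁆ : lookup ⁅ i ⁆ j ≡ false
    j∉⁅i⁆ = ¬-not (x≢y⇒x∉⁅y⁆ (i≢j ∘ sym) ∘ lookup⇒[]= j ⁅ i ⁆)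

─-distrib-△ : (p q d : Subset n) → (p △ q) ─ d ≡ (p ─ d) △ (q ─ d)
─-distrib-△ []      []      []          = refl
─-distrib-△ (x ∷ p) (y ∷ q) (true  ∷ d) = cong (false ∷_) (─-distrib-△ p q d)
─-distrib-△ (x ∷ p) (y ∷ q) (false ∷ d) = cong ((x xor y) ∷_) (─-distrib-△ p q d)

△-comm : (p q : Subset n) → p △ q ≡ q △ p
△-comm = zipWith-comm xor-comm

△-self : (p : Subset n) → ∣ p △ p ∣ ≡ 0
△-self []          = refl
△-self (true  ∷ p) = △-self p
△-self (false ∷ p) = △-self p

△-zero⇒≡ : (p q : Subset n) → ∣ p △ q ∣ ≡ 0 → p ≡ q
△-zero⇒≡ []          []          _ = refl
△-zero⇒≡ (true  ∷ p) (true  ∷ q) e = cong (true ∷_) (△-zero⇒≡ p q e)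
△-zero⇒≡ (false ∷ p) (false ∷ q) e = cong (false ∷_) (△-zero⇒≡ p q e)
△-zero⇒≡ (true  ∷ p) (false ∷ q) ()
△-zero⇒≡ (false ∷ p) (true  ∷ q) ()

Adj-transport : {A B C D : Subset n} → ∣ A △ B ∣ ≡ ∣ C △ D ∣ → Adj A B → Adj C D
Adj-transport e (lo , hi) = subst (1 ≤_) e lo , subst (_≤ 2) e hi

Adj-sym : {A B : Subset n} → Adj A B → Adj B A
Adj-sym {A = A} {B} = Adj-transport {A = A} {B} {B} {A} (cong ∣_∣ (△-comm A B))

Adj-irrefl : (A : Subset n) → ¬ Adj A A
Adj-irrefl A (lo , _) = n≮n 0 (subst (1 ≤_) (△-self A) lo)

length-≤-by-injection : {A B : Set} (f : A → B) {xs : List A} {ys : List B} → Unique xs →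
  (∀ {x} → x ∈ xs → f x ∈ ys) → (∀ {x y} → x ∈ xs → y ∈ xs → f x ≡ f y → x ≡ y) →
  length xs ≤ length ys
length-≤-by-injection f {[]}     _            _    _   = z≤n
length-≤-by-injection f {x ∷ xs} (x∉xs ∷ uxs) into inj with ∈-∃++ (into (here refl))
... | ys₁ , ys₂ , refl = ≤-trans
  (s≤s (length-≤-by-injection f uxs into′ (λ p q → inj (there p) (there q))))
  (≤-reflexive (sym (length-++-sucʳ ys₁ (f x) ys₂)))
  where
    -- the other elements of xs avoid the slot occupied by f x
    into′ : ∀ {y} → y ∈ xs → f y ∈ ys₁ ++ ys₂
    into′ {y} y∈ with ∈-++⁻ ys₁ (into (there y∈))
    ... | inj₁ p         = ∈-++⁺ˡ p
    ... | inj₂ (there p) = ∈-++⁺ʳ ys₁ p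
    ... | inj₂ (here e)  = ⊥-elim (All-lookup x∉xs y∈ (inj (here refl) (there y∈) (sym e)))

length-deduplicate : {A : Set} (_≟_ : (a b : A) → Dec (a ≡ b)) (xs : List A) →
  length (deduplicate _≟_ xs) ≤ length xs
length-deduplicate _≟_ []       = z≤n
length-deduplicate _≟_ (x ∷ xs) =
  s≤s (≤-trans (length-filter _ (deduplicate _≟_ xs)) (length-deduplicate _≟_ xs))

module PairCounting {X : Set} {R : X → X → Set} (R? : (a b : X) → Dec (R a b)) where

  RelatedPair : X × X → Set
  RelatedPair (a , b) = R a b

  related? : (p : X × X) → Dec (RelatedPair p)
  related? (a , b) = R? a b

  pairsBetween : List X → List X → List (X × X)
  pairsBetween G H = filter related? (cartesianProduct G H)

  orderedPairs : List X → List (X × X)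
  orderedPairs F = pairsBetween F F

  ∈-orderedPairs⁻ : {F : List X} {a b : X} → (a , b) ∈ orderedPairs F → a ∈ F × b ∈ F × R a b
  ∈-orderedPairs⁻ {F} p with ∈-filter⁻ related? p
  ... | q , r with ∈-cartesianProduct⁻ F F q
  ...   | a∈ , b∈ = a∈ , b∈ , r

  ∈-orderedPairs⁺ : {F : List X} {a b : X} → a ∈ F → b ∈ F → R a b → (a , b) ∈ orderedPairs F
  ∈-orderedPairs⁺ a∈ b∈ r = ∈-filter⁺ related? (∈-cartesianProduct⁺ a∈ b∈) r

  orderedPairs-unique : {F : List X} → Unique F → Unique (orderedPairs F)
  orderedPairs-unique u = filter⁺ related? (cartesianProduct⁺ u u)

  outDegree inDegree : X → List X → ℕ
  outDegree a H = length (filter (R? a) H)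
  inDegree  a G = length (filter (λ b → R? b a) G)

  edgeCount : List X → ℕ
  edgeCount []      = 0
  edgeCount (a ∷ F) = outDegree a F + edgeCount F

  pairsBetween-∷ˡ : (a : X) (G H : List X) →
    length (pairsBetween (a ∷ G) H) ≡ outDegree a H + length (pairsBetween G H)
  pairsBetween-∷ˡ a G H = begin
      length (filter related? (map (a ,_) H ++ cartesianProduct G H))
    ≡⟨ cong length (filter-++ related? (map (a ,_) H) (cartesianProduct G H)) ⟩
      length (filter related? (map (a ,_) H) ++ pairsBetween G H)
    ≡⟨ length-++ (filter related? (map (a ,_) H)) ⟩
      length (filter related? (map (a ,_) H)) + length (pairsBetween G H)
    ≡⟨ cong (_+ length (pairsBetween G H)) (row H) ⟩
      outDegree a H + length (pairsBetween G H)
    ∎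
    where
      open ≡-Reasoning
      row : (H : List X) → length (filter related? (map (a ,_) H)) ≡ outDegree a H
      row []      = refl
      row (b ∷ H) with R? a b
      ... | yes _ = cong suc (row H)
      ... | no  _ = row H

  pairsBetween-∷ʳ : (a : X) (G H : List X) →
    length (pairsBetween G (a ∷ H)) ≡ inDegree a G + length (pairsBetween G H)
  pairsBetween-∷ʳ a []      H = refl
  pairsBetween-∷ʳ a (b ∷ G) H
    rewrite pairsBetween-∷ˡ b G (a ∷ H) | pairsBetween-∷ˡ b G H | pairsBetween-∷ʳ a G H
    with R? b a
  ... | yes _ = cong suc (x∙yz≈y∙xz (outDegree b H) (inDegree a G) _)
  ... | no  _ = x∙yz≈y∙xz (outDegree b H) (inDegree a G) _

  module _ (R-sym : ∀ {a b} → R a b → R b a) (R-irrefl : ∀ a → ¬ R a a) where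

    length-orderedPairs : (F : List X) → length (orderedPairs F) ≡ 2 * edgeCount F
    length-orderedPairs []      = refl
    length-orderedPairs (a ∷ F) = begin
        length (pairsBetween (a ∷ F) (a ∷ F))
      ≡⟨ pairsBetween-∷ˡ a F (a ∷ F) ⟩
        outDegree a (a ∷ F) + length (pairsBetween F (a ∷ F))
      ≡⟨ cong₂ _+_ (cong length (filter-reject (R? a) (R-irrefl a))) (pairsBetween-∷ʳ a F F) ⟩
        outDegree a F + (inDegree a F + length (orderedPairs F))
      ≡⟨ cong₂ (λ d e → outDegree a F + (d + e))
               (cong length (filter-≐ (λ b → R? b a) (R? a) (R-sym , R-sym) F))
               (length-orderedPairs F) ⟩
        outDegree a F + (outDegree a F + 2 * edgeCount F)
      ≡⟨ double (outDegree a F) (edgeCount F) ⟩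
        2 * edgeCount (a ∷ F)
      ∎
      where
        open ≡-Reasoning
        double : ∀ d e → d + (d + 2 * e) ≡ 2 * (d + e)
        double = solve-∀

module OrderedEdges {n : ℕ} where

  open PairCounting (Adj? {n}) public
    using (orderedPairs; ∈-orderedPairs⁻; ∈-orderedPairs⁺; orderedPairs-unique)
  open PairCounting (Adj? {n}) using (edgeCount; length-orderedPairs)

  edges≡edgeCount : (F : List (Subset n)) → edges F ≡ edgeCount F
  edges≡edgeCount []      = refl
  edges≡edgeCount (A ∷ F) = cong (length (filter (Adj? A) F) +_) (edges≡edgeCount F)

  length-orderedEdges : (F : List (Subset n)) → length (orderedPairs F) ≡ 2 * edges F
  length-orderedEdges F = trans
    (length-orderedPairs (λ {A} {B} → Adj-sym {A = A} {B}) Adj-irrefl F)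
    (cong (2 *_) (sym (edges≡edgeCount F)))

module Shifting {n : ℕ} {i j : Fin n} (i≢j : i ≢ j) (𝒮 : List (Subset n)) where

  pair : Subset n
  pair = ⁅ i ⁆ ∪ ⁅ j ⁆

  clear : Subset n → Subset n
  clear S = S ─ pair

  record Full (S : Subset n) : Set where
    constructor full
    field
      i∈ : lookup S i ≡ true
      j∈ : lookup S j ≡ true

  clear-i : (S : Subset n) → lookup (clear S) i ≡ false
  clear-i S = lookup-─-inside S pair i ([]=⇒lookup (x∈p∪q⁺ (inj₁ (x∈⁅x⁆ i))))

  clear-j : (S : Subset n) → lookup (clear S) j ≡ false
  clear-j S = lookup-─-inside S pair j ([]=⇒lookup (x∈p∪q⁺ {p = ⁅ i ⁆} (inj₂ (x∈⁅x⁆ j))))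

  clear-idem : (S : Subset n) → clear (clear S) ≡ clear S
  clear-idem S = p─q─q≡p─q S pair

  distance-split : (A B : Subset n) → ∣ A △ B ∣ ≡
    bit (lookup A i xor lookup B i) + (bit (lookup A j xor lookup B j) + ∣ clear A △ clear B ∣)
  distance-split A B
    rewrite sym (lookup-zipWith _xor_ i A B) | sym (lookup-zipWith _xor_ j A B)
          | sym (─-distrib-△ A B pair)
    = card-split₂ i≢j (A △ B)

  full-distance : {A B : Subset n} → Full A → Full B → ∣ A △ B ∣ ≡ ∣ clear A △ clear B ∣
  full-distance {A} {B} (full ai aj) (full bi bj) rewrite distance-split A B | ai | aj | bi | bj = refl

  from-full : {A : Subset n} → Full A → (B : Subset n) → ∣ A △ B ∣ ≡
    bit (not (lookup B i)) + (bit (not (lookup B j)) + ∣ clear A △ clear B ∣)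
  from-full {A} (full ai aj) B rewrite distance-split A B | ai | aj = refl

  from-clear : (A B : Subset n) → ∣ clear A △ B ∣ ≡
    bit (lookup B i) + (bit (lookup B j) + ∣ clear A △ clear B ∣)
  from-clear A B rewrite distance-split (clear A) B | clear-i A | clear-j A | clear-idem A = refl

  one-sided-distance : {A B : Subset n} → Full A → lookup B i ≡ not (lookup B j) →
    ∣ A △ B ∣ ≡ ∣ clear A △ B ∣
  one-sided-distance {A} {B} fA e =
    trans (from-full fA B) (trans (flip-bits e _) (sym (from-clear A B)))
    where
      flip-bits : ∀ {x y} → x ≡ not y → ∀ d → bit (not x) + (bit (not y) + d) ≡ bit x + (bit y + d)
      flip-bits {y = true}  refl d = refl
      flip-bits {y = false} refl d = refl

  avoiding-distance : {A B : Subset n} → Full A → lookup B i ≡ false → lookup B j ≡ false →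
    ∣ A △ B ∣ ≡ 2 + ∣ clear A △ B ∣
  avoiding-distance {A} {B} fA bi bj rewrite from-full fA B | from-clear A B | bi | bj = refl

  full-clear-distance : {A B : Subset n} → Full A → Full B → ∣ A △ clear B ∣ ≡ 2 + ∣ A △ B ∣
  full-clear-distance {A} {B} fA fB
    rewrite from-full fA (clear B) | clear-i B | clear-j B | clear-idem B | full-distance fA fB = refl

  full-edge-breaks : {A B : Subset n} → Full A → Full B → Adj A B → ¬ Adj A (clear B)
  full-edge-breaks {A} {B} fA fB (lo , _) (_ , hi) =
    too-far lo (subst (_≤ 2) (full-clear-distance fA fB) hi)
    where
      too-far : ∀ {d} → 1 ≤ d → ¬ (2 + d ≤ 2)
      too-far (s≤s _) (s≤s (s≤s ()))

  clear-injective : {A C : Subset n} → Full A → Full C → clear A ≡ clear C → A ≡ C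
  clear-injective {A} {C} fA fC e = △-zero⇒≡ A C (begin
      ∣ A △ C ∣                 ≡⟨ full-distance fA fC ⟩
      ∣ clear A △ clear C ∣     ≡⟨ cong (λ X → ∣ clear A △ X ∣) (sym e) ⟩
      ∣ clear A △ clear A ∣     ≡⟨ △-self (clear A) ⟩
      0                         ∎)
    where open ≡-Reasoning

  Φ : Subset n → Subset n
  Φ = φ i j 𝒮

  shifted : List (Subset n)
  shifted = shift i j 𝒮

  data ShiftView (S : Subset n) : Subset n → Set where
    moves : Full S → clear S ∉ 𝒮 → ShiftView S (clear S)
    stays : (Full S → clear S ∈ 𝒮) → ShiftView S S

  shift-view : (S : Subset n) → ShiftView S (Φ S)
  shift-view S with (i ∈? S) ×-dec (j ∈? S)
  ... | no ¬full = stays (λ (full si sj) → ⊥-elim (¬full (lookup⇒[]= i S si , lookup⇒[]= j S sj)))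
  ... | yes (si , sj) with (S ─ (⁅ i ⁆ ∪ ⁅ j ⁆)) ∈ᶠ? 𝒮
  ...   | yes c∈ = stays (λ _ → c∈)
  ...   | no  c∉ = moves (full ([]=⇒lookup si) ([]=⇒lookup sj)) c∉

  -- A cleared set is never full, so the shift leaves it in place.
  Φ-clear : (S : Subset n) → Φ (clear S) ≡ clear S
  Φ-clear S with Φ (clear S) | shift-view (clear S)
  ... | _ | moves (full ci _) _ = ⊥-elim (false≢true (trans (sym (clear-i S)) ci))
    where false≢true : false ≢ true
          false≢true ()
  ... | _ | stays _ = refl

  Φ-injective : {A C : Subset n} → A ∈ 𝒮 → C ∈ 𝒮 → Φ A ≡ Φ C → A ≡ C
  Φ-injective {A} {C} A∈ C∈ e with Φ A | shift-view A | Φ C | shift-view C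
  ... | _ | moves fA _   | _ | moves fC _   = clear-injective fA fC e
  ... | _ | stays _      | _ | stays _      = e
  ... | _ | moves _ cA∉  | _ | stays _      = ⊥-elim (cA∉ (subst (_∈ 𝒮) (sym e) C∈))
  ... | _ | stays _      | _ | moves _ cC∉  = ⊥-elim (cC∉ (subst (_∈ 𝒮) e A∈))

  Φ-∈ : {S : Subset n} → S ∈ 𝒮 → Φ S ∈ shifted
  Φ-∈ S∈ = ∈-deduplicate⁺ _≟ˢ_ (∈-map⁺ Φ S∈)

  clear-∈ : {S : Subset n} → S ∈ 𝒮 → Full S → clear S ∈ shifted
  clear-∈ {S} S∈ fS with Φ S | shift-view S | Φ-∈ S∈
  ... | _ | moves _ _ | ΦS∈ = ΦS∈
  ... | _ | stays c∈  | _   = subst (_∈ shifted) (Φ-clear S) (Φ-∈ (c∈ fS))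

  shift-preserves-vertices : Unique 𝒮 → vertices 𝒮 ≡ vertices shifted
  shift-preserves-vertices u = ≤-antisym
    (length-≤-by-injection Φ u Φ-∈ Φ-injective)
    (≤-trans (length-deduplicate _≟ˢ_ (map Φ 𝒮)) (≤-reflexive (length-map Φ 𝒮)))

  MovesAlone : Subset n → Subset n → Set
  MovesAlone A B = Full A × Full B × clear A ∉ 𝒮 × clear B ∈ 𝒮

  Torn : Subset n → Subset n → Set
  Torn A B = MovesAlone A B ⊎ MovesAlone B A

  full? : (S : Subset n) → Dec (Full S)
  full? S = map′ (λ (si , sj) → full si sj) (λ (full si sj) → si , sj)
                 ((lookup S i ≟ᵇ true) ×-dec (lookup S j ≟ᵇ true))

  moves-alone? : (A B : Subset n) → Dec (MovesAlone A B)
  moves-alone? A B = full? A ×-dec full? B ×-dec ¬? (clear A ∈ᶠ? 𝒮) ×-dec (clear B ∈ᶠ? 𝒮)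

  torn? : (A B : Subset n) → Dec (Torn A B)
  torn? A B = moves-alone? A B ⊎-dec moves-alone? B A

  torn-full : {A B : Subset n} → Torn A B → Full A × Full B
  torn-full (inj₁ (fA , fB , _)) = fA , fB
  torn-full (inj₂ (fB , fA , _)) = fA , fB

  one-sided-keeps-edge : {A B : Subset n} → Full A → lookup B i ≡ not (lookup B j) →
    Adj A B → Adj (clear A) B
  one-sided-keeps-edge {A} {B} fA e = Adj-transport {A = A} {B} {clear A} {B} (one-sided-distance fA e)

  moving-keeps-edge : {A B : Subset n} → Full A → clear A ∉ 𝒮 → B ∈ 𝒮 → ¬ Full B →
    Adj A B → Adj (clear A) B
  moving-keeps-edge {A} {B} fA cA∉ B∈ ¬fB adj with lookup B i in bi | lookup B j in bj
  ... | true  | true  = ⊥-elim (¬fB (full bi bj))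
  ... | true  | false = one-sided-keeps-edge {A} {B} fA (trans bi (cong not (sym bj))) adj
  ... | false | true  = one-sided-keeps-edge {A} {B} fA (trans bi (cong not (sym bj))) adj
  ... | false | false = ⊥-elim (cA∉ (subst (_∈ 𝒮) (sym clearA≡B) B∈))
    where
      -- B is within distance 2 of A and avoids i, j, so it must be clear A
      clearA≡B : clear A ≡ B
      clearA≡B = △-zero⇒≡ (clear A) B
        (n≤0⇒n≡0 (≤-pred (≤-pred (subst (_≤ 2) (avoiding-distance {A} {B} fA bi bj) (proj₂ adj)))))

  shift-keeps-edge : {A B : Subset n} → A ∈ 𝒮 → B ∈ 𝒮 → ¬ Torn A B → Adj A B → Adj (Φ A) (Φ B)
  shift-keeps-edge {A} {B} A∈ B∈ ¬torn adj with Φ A | shift-view A | Φ B | shift-view B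
  ... | _ | moves fA _   | _ | moves fB _   =
    Adj-transport {A = A} {B} {clear A} {clear B} (full-distance fA fB) adj
  ... | _ | stays _      | _ | stays _      = adj
  ... | _ | moves fA cA∉ | _ | stays cB∈    =
    moving-keeps-edge fA cA∉ B∈ (λ fB → ¬torn (inj₁ (fA , fB , cA∉ , cB∈ fB))) adj
  ... | _ | stays cA∈    | _ | moves fB cB∉ = Adj-sym {A = clear B} {A}
    (moving-keeps-edge fB cB∉ A∈ (λ fA → ¬torn (inj₂ (fB , fA , cB∉ , cA∈ fA))) (Adj-sym {A = A} {B} adj))

  moved-preimage : {A C : Subset n} → C ∈ 𝒮 → Full A → clear A ∉ 𝒮 → clear A ≡ Φ C → C ≡ A
  moved-preimage {A} {C} C∈ fA cA∉ e with Φ C | shift-view C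
  ... | _ | moves fC _ = clear-injective fC fA (sym e)
  ... | _ | stays _    = ⊥-elim (cA∉ (subst (_∈ 𝒮) (sym e) C∈))

  -- The cleared image of an edge whose first end moves alone is not the image
  -- of any edge under the shift: it would be an edge from A to clear B.
  moves-alone-collision : {A B C D : Subset n} → MovesAlone A B → Adj A B →
    C ∈ 𝒮 → D ∈ 𝒮 → Adj C D → clear A ≡ Φ C → clear B ≡ Φ D → ⊥
  moves-alone-collision {A} {B} {C} {D} (fA , fB , cA∉ , cB∈) adj C∈ D∈ adjCD e₁ e₂ =
    full-edge-breaks fA fB adj (subst₂ Adj C≡A D≡clearB adjCD)
    where
      C≡A : C ≡ A
      C≡A = moved-preimage C∈ fA cA∉ e₁
      D≡clearB : D ≡ clear B
      D≡clearB = Φ-injective D∈ cB∈ (trans (sym e₂) (sym (Φ-clear B)))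

  torn-collision : {A B C D : Subset n} → Torn A B → Adj A B →
    C ∈ 𝒮 → D ∈ 𝒮 → Adj C D → clear A ≡ Φ C → clear B ≡ Φ D → ⊥
  torn-collision (inj₁ m) adj C∈ D∈ adjCD e₁ e₂ = moves-alone-collision m adj C∈ D∈ adjCD e₁ e₂
  torn-collision {A} {B} {C} {D} (inj₂ m) adj C∈ D∈ adjCD e₁ e₂ =
    moves-alone-collision m (Adj-sym {A = A} {B} adj) D∈ C∈ (Adj-sym {A = C} {D} adjCD) e₂ e₁

  open OrderedEdges {n}

  edge-image : Subset n × Subset n → Subset n × Subset n
  edge-image (A , B) with torn? A B
  ... | yes _ = clear A , clear B
  ... | no  _ = Φ A , Φ B

  data EdgeImageView : Subset n × Subset n → Subset n × Subset n → Set where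
    cleared : {A B : Subset n} → Torn A B → EdgeImageView (A , B) (clear A , clear B)
    moved   : {A B : Subset n} → ¬ Torn A B → EdgeImageView (A , B) (Φ A , Φ B)

  edge-image-view : (p : Subset n × Subset n) → EdgeImageView p (edge-image p)
  edge-image-view (A , B) with torn? A B
  ... | yes t = cleared t
  ... | no ¬t = moved ¬t

  edge-image-∈ : {p : Subset n × Subset n} → p ∈ orderedPairs 𝒮 → edge-image p ∈ orderedPairs shifted
  edge-image-∈ {p} p∈ with edge-image p | edge-image-view p
  ... | _ | cleared {A} {B} t =
    let A∈ , B∈ , adj = ∈-orderedPairs⁻ {𝒮} p∈; fA , fB = torn-full t in
    ∈-orderedPairs⁺ {shifted} (clear-∈ A∈ fA) (clear-∈ B∈ fB)
      (Adj-transport {A = A} {B} {clear A} {clear B} (full-distance fA fB) adj)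
  ... | _ | moved ¬t =
    let A∈ , B∈ , adj = ∈-orderedPairs⁻ {𝒮} p∈ in
    ∈-orderedPairs⁺ {shifted} (Φ-∈ A∈) (Φ-∈ B∈) (shift-keeps-edge A∈ B∈ ¬t adj)

  edge-image-injective : {p q : Subset n × Subset n} → p ∈ orderedPairs 𝒮 → q ∈ orderedPairs 𝒮 →
    edge-image p ≡ edge-image q → p ≡ q
  edge-image-injective {p} {q} p∈ q∈ e
    with edge-image p | edge-image-view p | edge-image q | edge-image-view q
  ... | _ | cleared t | _ | cleared t′ = let fA , fB = torn-full t; fC , fD = torn-full t′ in
    cong₂ _,_ (clear-injective fA fC (cong proj₁ e)) (clear-injective fB fD (cong proj₂ e))
  ... | _ | moved _ | _ | moved _ =
    let A∈ , B∈ , _ = ∈-orderedPairs⁻ {𝒮} p∈; C∈ , D∈ , _ = ∈-orderedPairs⁻ {𝒮} q∈ in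
    cong₂ _,_ (Φ-injective A∈ C∈ (cong proj₁ e)) (Φ-injective B∈ D∈ (cong proj₂ e))
  ... | _ | cleared t | _ | moved _ =
    let _ , _ , adjAB = ∈-orderedPairs⁻ {𝒮} p∈; C∈ , D∈ , adjCD = ∈-orderedPairs⁻ {𝒮} q∈ in
    ⊥-elim (torn-collision t adjAB C∈ D∈ adjCD (cong proj₁ e) (cong proj₂ e))
  ... | _ | moved _ | _ | cleared t =
    let A∈ , B∈ , adjAB = ∈-orderedPairs⁻ {𝒮} p∈; _ , _ , adjCD = ∈-orderedPairs⁻ {𝒮} q∈ in
    ⊥-elim (torn-collision t adjCD A∈ B∈ adjAB (cong proj₁ (sym e)) (cong proj₂ (sym e)))

  shift-increases-edges : Unique 𝒮 → edges 𝒮 ≤ edges shifted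
  shift-increases-edges u = *-cancelˡ-≤ 2
    (subst₂ _≤_ (length-orderedEdges 𝒮) (length-orderedEdges shifted)
      (length-≤-by-injection edge-image (orderedPairs-unique u) edge-image-∈ edge-image-injective))

proposition1 : {n : ℕ} (𝒮 : List (Subset n)) → Unique 𝒮 → Pointed 𝒮 → Even-family 𝒮 →
    (i j : Fin n) → i ≢ j →
    (vertices 𝒮 ≡ vertices (shift i j 𝒮)) × (edges 𝒮 ≤ edges (shift i j 𝒮))
proposition1 𝒮 u _ _ i j i≢j = shift-preserves-vertices u , shift-increases-edges u
  where open Shifting i≢j 𝒮
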